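{- Let $n$ be a positive integer and let $0 \le k \le \nu_2(n)+1$, where $\nu_2(n)$ is the exponent of the largest power of $2$ dividing $n$. Then $S := \langle n, n+2^0, n+2^1, \ldots, n+2^k\rangle$ is a numerical semigroup with Frobenius number $$F(S) = \begin{cases} \dfrac{n^2}{2^k} + (k-1)n - 1, & \text{if } k \le \nu_2(n),\\[6pt] \dfrac{n^2}{2^k} + \left(k - \tfrac{3}{2}\right)n - 1, & \text{if } k = \nu_2(n)+1.\end{cases}$$
   Context: $\mathbb{N}$ denotes the nonnegative integers. For positive integers $a_1,\dots,a_m$, $\langle a_1,\dots,a_m\rangle = \{a_1x_1+\dots+a_mx_m : x_i\in\mathbb{N}\}$. A numerical semigroup is a submonoid $S\subseteq\mathbb{N}$ with $\mathbb{N}\setminus S$ finite; its Frobenius number $F(S)$ is the largest integer not in $S$ (with $F(\mathbb{N})=-1$). -}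

module Defs where

open import Data.Nat using (ℕ; zero; suc; _+_; _*_; _^_; _≤_)
open import Data.Nat.Divisibility using (_∣_)
open import Data.Integer as ℤ using (ℤ; +_; -[1+_])
open import Data.List using (List; []; _∷_; map; upTo)
open import Data.Product using (Σ; ∃; _×_; _,_)
open import Data.Sum using (_⊎_)
open import Relation.Binary.PropositionalEquality using (_≡_)
open import Relation.Nullary using (¬_)

InMonoid : List ℕ → ℕ → Set
InMonoid []       x = x ≡ 0
InMonoid (a ∷ as) x = Σ ℕ λ c → Σ ℕ λ y → InMonoid as y × x ≡ c * a + y

record IsNumericalSemigroup (S : ℕ → Set) : Set where
  field
    zero∈ : S 0
    +-closed : ∀ x y → S x → S y → S (x + y)
    cofinite : Σ ℕ λ B → ∀ x → B ≤ x → S x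

-- f is the Frobenius number of S: the largest integer not in S,
-- with the convention F(ℕ) = -1.
IsFrobenius : (ℕ → Set) → ℤ → Set
IsFrobenius S f =
  (f ≡ -[1+ 0 ] ⊎ Σ ℕ (λ m → f ≡ + m × ¬ S m))
  × (∀ x → f ℤ.< + x → S x)

IsNu2 : ℕ → ℕ → Set
IsNu2 n v = (2 ^ v ∣ n) × ¬ (2 ^ suc v ∣ n)

gens : ℕ → ℕ → List ℕ
gens n k = n ∷ map (λ i → n + 2 ^ i) (upTo (suc k))

module Submission where

-- A sum of j generators n + t (t = 0 or t = 2^e, e ≤ k) is j·n plus a sum of at most j powers 2^e,
-- so x ∈ S iff x = j·n + r with weight k r ≤ j, where weight k r is the least number of such powers
-- summing to r.  If every r < n has weight at most c and every r ≡ -1 (mod n) has weight at least c,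
-- then S contains every x ≥ n·c but not n·c - 1, so F(S) = n·c - 1.  For n = (q+1)·2^k one gets
-- c = q + k, and for n = (2p+1)·2^v, k = v + 1, one gets c = p + v: here the numbers ≡ -1 (mod n)
-- are a·2^k + (2^k - 1) or a·2^k + (2^v - 1), whose weights are a + k and a + v.

open import Data.Nat using (ℕ; zero; suc; _+_; _*_; _^_; _≤_; _<_; z≤n; s≤s; z<s; >-nonZero; ⌊_/2⌋)
open import Data.Nat.Properties
open import Data.Nat.DivMod using (_/_; _%_; m%n<n; m≡m%n+[m/n]*n; m*n/n≡m; /-monoˡ-≤)
open import Data.Nat.Divisibility using (_∣_; divides; ∣-trans)
import Data.Nat.Tactic.RingSolver as ℕ-Ring
open import Data.Integer as ℤ using (ℤ; +_)
import Data.Integer.Properties as ℤP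
import Data.Integer.Tactic.RingSolver as ℤ-Ring
open import Data.List using ([]; _∷_)
open import Data.List.Membership.Propositional using (_∈_)
open import Data.List.Membership.Propositional.Properties using (∈-map⁺; ∈-upTo⁺)
open import Data.List.Relation.Unary.Any using (here; there)
open import Data.List.Relation.Unary.All using (All; []; _∷_)
import Data.List.Relation.Unary.All.Properties as All
open import Data.Product using (Σ; _×_; _,_; ∃-syntax)
open import Data.Sum using (_⊎_; inj₁; inj₂)
open import Function using (id; _∘_)
open import Relation.Binary.PropositionalEquality
open import Relation.Nullary using (¬_; contradiction)

open import Defs

lowBit : ℕ → ℕ
lowBit zero = 0
lowBit (suc zero) = 1
lowBit (suc (suc r)) = lowBit r

-- weight k r = ⌊r / 2^k⌋ + (binary digit sum of r mod 2^k)
weight : ℕ → ℕ → ℕ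
weight zero r = r
weight (suc k) r = lowBit r + weight k ⌊ r /2⌋

ones : ℕ → ℕ
ones zero = 0
ones (suc v) = 1 + 2 * ones v

data Halving : ℕ → Set where
  even : ∀ a → Halving (2 * a)
  odd  : ∀ a → Halving (1 + 2 * a)

halving : ∀ r → Halving r
halving zero = even 0
halving (suc r) with halving r
... | even a = odd a
... | odd a = subst Halving (*-suc 2 a) (even (suc a))

weight-even : ∀ k a → weight (suc k) (2 * a) ≡ weight k a
weight-even k a = cong₂ _+_ (lowBit-even a) (cong (weight k) (half-even a))
  where
  lowBit-even : ∀ a → lowBit (2 * a) ≡ 0
  lowBit-even zero = refl
  lowBit-even (suc a) = trans (cong lowBit (*-suc 2 a)) (lowBit-even a)
  half-even : ∀ a → ⌊ 2 * a /2⌋ ≡ a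
  half-even zero = refl
  half-even (suc a) = trans (cong ⌊_/2⌋ (*-suc 2 a)) (cong suc (half-even a))

weight-odd : ∀ k a → weight (suc k) (1 + 2 * a) ≡ 1 + weight k a
weight-odd k a = cong₂ _+_ (lowBit-odd a) (cong (weight k) (half-odd a))
  where
  lowBit-odd : ∀ a → lowBit (1 + 2 * a) ≡ 1
  lowBit-odd zero = refl
  lowBit-odd (suc a) = trans (cong (lowBit ∘ suc) (*-suc 2 a)) (lowBit-odd a)
  half-odd : ∀ a → ⌊ 1 + 2 * a /2⌋ ≡ a
  half-odd zero = refl
  half-odd (suc a) = trans (cong (⌊_/2⌋ ∘ suc) (*-suc 2 a)) (cong suc (half-odd a))

weight-zero : ∀ k → weight k 0 ≡ 0
weight-zero zero = refl
weight-zero (suc k) = weight-zero k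

weight-suc : ∀ k r → weight k (suc r) ≤ suc (weight k r)
weight-suc zero r = ≤-refl
weight-suc (suc k) r with halving r
... | even a = ≤-reflexive (trans (weight-odd k a) (cong suc (sym (weight-even k a))))
... | odd a = begin
  weight (suc k) (2 + 2 * a)   ≡⟨ cong (weight (suc k)) (sym (*-suc 2 a)) ⟩
  weight (suc k) (2 * suc a)   ≡⟨ weight-even k (suc a) ⟩
  weight k (suc a)             ≤⟨ weight-suc k a ⟩
  suc (weight k a)             ≤⟨ n≤1+n _ ⟩
  suc (1 + weight k a)         ≡⟨ cong suc (sym (weight-odd k a)) ⟩
  suc (weight (suc k) (1 + 2 * a)) ∎
  where open ≤-Reasoning

weight-+ : ∀ k a b → weight k (a + b) ≤ weight k a + weight k b
weight-+ zero a b = ≤-refl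
weight-+ (suc k) a b with halving a | halving b
... | even x | even y = begin
  weight (suc k) (2 * x + 2 * y)   ≡⟨ cong (weight (suc k)) (sym (*-distribˡ-+ 2 x y)) ⟩
  weight (suc k) (2 * (x + y))     ≡⟨ weight-even k (x + y) ⟩
  weight k (x + y)                 ≤⟨ weight-+ k x y ⟩
  weight k x + weight k y          ≡⟨ sym (cong₂ _+_ (weight-even k x) (weight-even k y)) ⟩
  weight (suc k) (2 * x) + weight (suc k) (2 * y) ∎
  where open ≤-Reasoning
... | even x | odd y = begin
  weight (suc k) (2 * x + (1 + 2 * y)) ≡⟨ cong (weight (suc k)) (regroup x y) ⟩
  weight (suc k) (1 + 2 * (x + y))     ≡⟨ weight-odd k (x + y) ⟩
  1 + weight k (x + y)                 ≤⟨ s≤s (weight-+ k x y) ⟩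
  1 + (weight k x + weight k y)        ≡⟨ sym (+-suc (weight k x) (weight k y)) ⟩
  weight k x + (1 + weight k y)        ≡⟨ sym (cong₂ _+_ (weight-even k x) (weight-odd k y)) ⟩
  weight (suc k) (2 * x) + weight (suc k) (1 + 2 * y) ∎
  where
  open ≤-Reasoning
  regroup : ∀ x y → 2 * x + (1 + 2 * y) ≡ 1 + 2 * (x + y)
  regroup = ℕ-Ring.solve-∀
... | odd x | even y = begin
  weight (suc k) (1 + 2 * x + 2 * y)   ≡⟨ cong (weight (suc k) ∘ suc) (sym (*-distribˡ-+ 2 x y)) ⟩
  weight (suc k) (1 + 2 * (x + y))     ≡⟨ weight-odd k (x + y) ⟩
  1 + weight k (x + y)                 ≤⟨ s≤s (weight-+ k x y) ⟩
  1 + weight k x + weight k y          ≡⟨ sym (cong₂ _+_ (weight-odd k x) (weight-even k y)) ⟩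
  weight (suc k) (1 + 2 * x) + weight (suc k) (2 * y) ∎
  where open ≤-Reasoning
... | odd x | odd y = begin
  weight (suc k) (1 + 2 * x + (1 + 2 * y)) ≡⟨ cong (weight (suc k)) (regroup x y) ⟩
  weight (suc k) (2 * (1 + (x + y)))       ≡⟨ weight-even k (1 + (x + y)) ⟩
  weight k (1 + (x + y))                   ≤⟨ weight-suc k (x + y) ⟩
  1 + weight k (x + y)                     ≤⟨ s≤s (weight-+ k x y) ⟩
  1 + weight k x + weight k y              ≤⟨ +-monoʳ-≤ (1 + weight k x) (n≤1+n (weight k y)) ⟩
  1 + weight k x + (1 + weight k y)        ≡⟨ sym (cong₂ _+_ (weight-odd k x) (weight-odd k y)) ⟩
  weight (suc k) (1 + 2 * x) + weight (suc k) (1 + 2 * y) ∎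
  where
  open ≤-Reasoning
  regroup : ∀ x y → 1 + 2 * x + (1 + 2 * y) ≡ 2 * (1 + (x + y))
  regroup = ℕ-Ring.solve-∀

weight-*ˡ : ∀ k c t → weight k (c * t) ≤ c * weight k t
weight-*ˡ k zero t = ≤-reflexive (weight-zero k)
weight-*ˡ k (suc c) t = ≤-trans (weight-+ k t (c * t)) (+-monoʳ-≤ (weight k t) (weight-*ˡ k c t))

weight-pow : ∀ {k e} → e ≤ k → weight k (2 ^ e) ≡ 1
weight-pow {k} z≤n = weight-one k
  where
  weight-one : ∀ k → weight k 1 ≡ 1
  weight-one zero = refl
  weight-one (suc k) = cong suc (weight-zero k)
weight-pow {suc k} {suc e} (s≤s e≤k) = trans (weight-even k (2 ^ e)) (weight-pow e≤k)

weight-shift : ∀ k a b → weight k (a * 2 ^ k + b) ≡ a + weight k b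
weight-shift zero a b = cong (_+ b) (*-identityʳ a)
weight-shift (suc k) a b with halving b
... | even c = begin
  weight (suc k) (a * (2 * 2 ^ k) + 2 * c) ≡⟨ cong (weight (suc k)) (shift-even a (2 ^ k) c) ⟩
  weight (suc k) (2 * (a * 2 ^ k + c))     ≡⟨ weight-even k _ ⟩
  weight k (a * 2 ^ k + c)                 ≡⟨ weight-shift k a c ⟩
  a + weight k c                           ≡⟨ cong (_+_ a) (sym (weight-even k c)) ⟩
  a + weight (suc k) (2 * c)               ∎
  where
  open ≡-Reasoning
  shift-even : ∀ a p c → a * (2 * p) + 2 * c ≡ 2 * (a * p + c)
  shift-even = ℕ-Ring.solve-∀
... | odd c = begin
  weight (suc k) (a * (2 * 2 ^ k) + (1 + 2 * c)) ≡⟨ cong (weight (suc k)) (shift-odd a (2 ^ k) c) ⟩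
  weight (suc k) (1 + 2 * (a * 2 ^ k + c))       ≡⟨ weight-odd k _ ⟩
  1 + weight k (a * 2 ^ k + c)                   ≡⟨ cong suc (weight-shift k a c) ⟩
  1 + (a + weight k c)                           ≡⟨ sym (+-suc a (weight k c)) ⟩
  a + (1 + weight k c)                           ≡⟨ cong (_+_ a) (sym (weight-odd k c)) ⟩
  a + weight (suc k) (1 + 2 * c)                 ∎
  where
  open ≡-Reasoning
  shift-odd : ∀ a p c → a * (2 * p) + (1 + 2 * c) ≡ 1 + 2 * (a * p + c)
  shift-odd = ℕ-Ring.solve-∀

2^v≡1+ones : ∀ v → 2 ^ v ≡ suc (ones v)
2^v≡1+ones zero = refl
2^v≡1+ones (suc v) = trans (cong (2 *_) (2^v≡1+ones v)) (*-suc 2 (ones v))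

weight-ones : ∀ {k v} → v ≤ k → weight k (ones v) ≡ v
weight-ones {k} z≤n = weight-zero k
weight-ones {suc k} {suc v} (s≤s v≤k) = trans (weight-odd k (ones v)) (cong suc (weight-ones v≤k))

weight-pred-a*2^k+2^v : ∀ {k v r} a → v ≤ k → suc r ≡ a * 2 ^ k + 2 ^ v → weight k r ≡ a + v
weight-pred-a*2^k+2^v {k} {v} {r} a v≤k 1+r≡ = begin
  weight k r                   ≡⟨ cong (weight k) r≡ ⟩
  weight k (a * 2 ^ k + ones v) ≡⟨ weight-shift k a (ones v) ⟩
  a + weight k (ones v)         ≡⟨ cong (_+_ a) (weight-ones v≤k) ⟩
  a + v                         ∎
  where
  open ≡-Reasoning
  r≡ : r ≡ a * 2 ^ k + ones v
  r≡ = suc-injective (trans 1+r≡ (trans (cong (_+_ (a * 2 ^ k)) (2^v≡1+ones v)) (+-suc _ (ones v))))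

weight-<-pow : ∀ {k v b} → v ≤ k → b < 2 ^ v → weight k b ≤ v
weight-<-pow {k} {b = zero} z≤n _ = ≤-reflexive (weight-zero k)
weight-<-pow {b = suc b} z≤n (s≤s ())
weight-<-pow {suc k} {suc v} {b} (s≤s v≤k) b<2^1+v with halving b
... | even a = begin
  weight (suc k) (2 * a) ≡⟨ weight-even k a ⟩
  weight k a             ≤⟨ weight-<-pow v≤k (*-cancelˡ-< 2 a (2 ^ v) b<2^1+v) ⟩
  v                      ≤⟨ n≤1+n v ⟩
  suc v                  ∎
  where open ≤-Reasoning
... | odd a = begin
  weight (suc k) (1 + 2 * a) ≡⟨ weight-odd k a ⟩
  1 + weight k a             ≤⟨ s≤s (weight-<-pow v≤k (*-cancelˡ-< 2 a (2 ^ v) (<-trans (n<1+n _) b<2^1+v))) ⟩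
  suc v                      ∎
  where open ≤-Reasoning

weight-split : ∀ k r → 0 < r →
  ∃[ e ] ∃[ r′ ] e ≤ k × r ≡ 2 ^ e + r′ × weight k r ≡ suc (weight k r′)
weight-split zero (suc r) _ = 0 , r , z≤n , refl , refl
weight-split (suc k) r 0<r with halving r
... | odd a = 0 , 2 * a , z≤n , refl , trans (weight-odd k a) (cong suc (sym (weight-even k a)))
... | even zero = contradiction 0<r (<-irrefl refl)
... | even (suc a) with weight-split k (suc a) z<s
...   | e , a′ , e≤k , 1+a≡2^e+a′ , weight-1+a =
  suc e , 2 * a′ , s≤s e≤k ,
  trans (cong (2 *_) 1+a≡2^e+a′) (*-distribˡ-+ 2 (2 ^ e) a′) ,
  trans (weight-even k (suc a)) (trans weight-1+a (cong suc (sym (weight-even k a′))))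

InMonoid-0 : ∀ L → InMonoid L 0
InMonoid-0 [] = refl
InMonoid-0 (a ∷ L) = 0 , 0 , InMonoid-0 L , refl

InMonoid-+ : ∀ L {x y} → InMonoid L x → InMonoid L y → InMonoid L (x + y)
InMonoid-+ [] refl refl = refl
InMonoid-+ (a ∷ L) (c , x′ , x′∈ , refl) (d , y′ , y′∈ , refl) =
  c + d , x′ + y′ , InMonoid-+ L x′∈ y′∈ , regroup c a x′ d y′
  where
  regroup : ∀ c a x′ d y′ → (c * a + x′) + (d * a + y′) ≡ (c + d) * a + (x′ + y′)
  regroup = ℕ-Ring.solve-∀

InMonoid-∈ : ∀ {L g} → g ∈ L → InMonoid L g
InMonoid-∈ {a ∷ L} (here refl) = 1 , 0 , InMonoid-0 L , sym (trans (+-identityʳ _) (*-identityˡ a))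
InMonoid-∈ {a ∷ L} {g} (there g∈L) = 0 , g , InMonoid-∈ g∈L , refl

InMonoid-isNumericalSemigroup : ∀ L N → (∀ x → N ≤ x → InMonoid L x) → IsNumericalSemigroup (InMonoid L)
InMonoid-isNumericalSemigroup L N cofinite = record
  { zero∈ = InMonoid-0 L
  ; +-closed = λ _ _ → InMonoid-+ L
  ; cofinite = N , cofinite
  }

-- weight k t ≤ 1 holds exactly for t = 0 and t = 2^e with e ≤ k.
Admissible : ℕ → ℕ → ℕ → Set
Admissible n k g = ∃[ t ] g ≡ n + t × weight k t ≤ 1

InMonoid⇒weight≤ : ∀ n k L → All (Admissible n k) L → ∀ {x} → InMonoid L x →
  ∃[ j ] ∃[ r ] x ≡ j * n + r × weight k r ≤ j
InMonoid⇒weight≤ n k [] [] refl = 0 , 0 , refl , ≤-reflexive (weight-zero k)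
InMonoid⇒weight≤ n k (_ ∷ L) ((t , refl , weight-t≤1) ∷ admissible) (c , y , y∈ , refl)
  with InMonoid⇒weight≤ n k L admissible y∈
... | j , r , refl , weight-r≤j = c + j , c * t + r , regroup c n t j r , (begin
  weight k (c * t + r)           ≤⟨ weight-+ k (c * t) r ⟩
  weight k (c * t) + weight k r  ≤⟨ +-mono-≤ (weight-*ˡ k c t) weight-r≤j ⟩
  c * weight k t + j             ≤⟨ +-monoˡ-≤ j (*-monoʳ-≤ c weight-t≤1) ⟩
  c * 1 + j                      ≡⟨ cong (_+ j) (*-identityʳ c) ⟩
  c + j                          ∎)
  where
  open ≤-Reasoning
  regroup : ∀ c n t j r → c * (n + t) + (j * n + r) ≡ (c + j) * n + (c * t + r)
  regroup = ℕ-Ring.solve-∀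

gens-admissible : ∀ n k → All (Admissible n k) (gens n k)
gens-admissible n k =
  (0 , sym (+-identityʳ n) , ≤-trans (≤-reflexive (weight-zero k)) z≤n) ∷
  All.map⁺ (All.applyUpTo⁺₁ id (suc k) λ {i} i<1+k → 2 ^ i , refl , ≤-reflexive (weight-pow (≤-pred i<1+k)))

weight≤⇒InMonoid-gens : ∀ n k j r → weight k r ≤ j → InMonoid (gens n k) (j * n + r)
weight≤⇒InMonoid-gens n k zero zero _ = InMonoid-0 (gens n k)
weight≤⇒InMonoid-gens n k zero (suc r) weight≤0 with weight-split k (suc r) z<s
... | _ , _ , _ , _ , weight≡1+ = contradiction (subst (_≤ 0) weight≡1+ weight≤0) λ ()
weight≤⇒InMonoid-gens n k (suc j) zero _ =
  subst (InMonoid (gens n k)) (sym (+-assoc n (j * n) 0))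
    (InMonoid-+ (gens n k) (InMonoid-∈ (here refl)) (weight≤⇒InMonoid-gens n k j 0 (≤-trans (≤-reflexive (weight-zero k)) z≤n)))
weight≤⇒InMonoid-gens n k (suc j) (suc r) weight≤1+j with weight-split k (suc r) z<s
... | e , r′ , e≤k , 1+r≡2^e+r′ , weight≡1+ =
  subst (InMonoid (gens n k)) (trans (regroup n (2 ^ e) j r′) (cong (_+_ (suc j * n)) (sym 1+r≡2^e+r′)))
    (InMonoid-+ (gens n k) generator (weight≤⇒InMonoid-gens n k j r′ (≤-pred (subst (_≤ suc j) weight≡1+ weight≤1+j))))
  where
  generator : InMonoid (gens n k) (n + 2 ^ e)
  generator = InMonoid-∈ (there (∈-map⁺ (λ i → n + 2 ^ i) (∈-upTo⁺ (s≤s e≤k))))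
  regroup : ∀ n t j r → (n + t) + (j * n + r) ≡ suc j * n + (t + r)
  regroup = ℕ-Ring.solve-∀

isFrobenius : ∀ {S : ℕ → Set} N → (∀ x → N ≤ x → S x) → (∀ m → N ≡ suc m → ¬ S m) →
  IsFrobenius S (+ N ℤ.- + 1)
isFrobenius zero above _ = inj₁ refl , λ x _ → above x z≤n
isFrobenius (suc m) above gap = inj₂ (m , refl , gap m refl) , λ x m<x → above x (ℤP.drop‿+<+ m<x)

gens-cofinite : ∀ n k c → 0 < n → (∀ r → r < n → weight k r ≤ c) →
  ∀ x → n * c ≤ x → InMonoid (gens n k) x
gens-cofinite n k c 0<n residue-bound x nc≤x =
  subst (InMonoid (gens n k)) x≡ (weight≤⇒InMonoid-gens n k (x / n) (x % n) (≤-trans (residue-bound _ (m%n<n x n)) c≤x/n))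
  where
  instance _ = >-nonZero 0<n
  x≡ : x / n * n + x % n ≡ x
  x≡ = trans (+-comm _ (x % n)) (sym (m≡m%n+[m/n]*n x n))
  c≤x/n : c ≤ x / n
  c≤x/n = subst (_≤ x / n) (m*n/n≡m c n) (/-monoˡ-≤ n (subst (_≤ x) (*-comm n c) nc≤x))

j*n+r<n*c⇒j<c : ∀ j r n c → j * n + r < n * c → j < c
j*n+r<n*c⇒j<c j r n c j*n+r<n*c = *-cancelʳ-< n j c (begin-strict
  j * n      ≤⟨ m≤m+n (j * n) r ⟩
  j * n + r  <⟨ j*n+r<n*c ⟩
  n * c      ≡⟨ *-comm n c ⟩
  c * n      ∎)
  where open ≤-Reasoning

gens-gap : ∀ n k c → (∀ s r → suc r ≡ n * suc s → c ≤ weight k r) →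
  ∀ m → n * c ≡ suc m → ¬ InMonoid (gens n k) m
gens-gap n k c multiple-bound m nc≡1+m m∈
  with InMonoid⇒weight≤ n k (gens n k) (gens-admissible n k) m∈
... | j , r , refl , weight-r≤j with m≤n⇒∃[o]m+o≡n (j*n+r<n*c⇒j<c j r n c (≤-reflexive (sym nc≡1+m)))
...   | i , refl = m+n≮m j i (≤-trans (multiple-bound i r 1+r≡n[1+i]) weight-r≤j)
  where
  1+r≡n[1+i] : suc r ≡ n * suc i
  1+r≡n[1+i] = +-cancelˡ-≡ (j * n) _ _ (begin
    j * n + suc r        ≡⟨ +-suc (j * n) r ⟩
    suc (j * n + r)      ≡⟨ sym nc≡1+m ⟩
    n * (suc j + i)      ≡⟨ split n j i ⟩
    j * n + n * suc i    ∎)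
    where
    open ≡-Reasoning
    split : ∀ n j i → n * (suc j + i) ≡ j * n + n * suc i
    split = ℕ-Ring.solve-∀

gens-frobenius : ∀ n k c → 0 < n →
  (∀ r → r < n → weight k r ≤ c) →
  (∀ s r → suc r ≡ n * suc s → c ≤ weight k r) →
  IsNumericalSemigroup (InMonoid (gens n k)) × IsFrobenius (InMonoid (gens n k)) (+ (n * c) ℤ.- + 1)
gens-frobenius n k c 0<n residue-bound multiple-bound =
  InMonoid-isNumericalSemigroup (gens n k) (n * c) cofinite ,
  isFrobenius (n * c) cofinite (gens-gap n k c multiple-bound)
  where
  cofinite : ∀ x → n * c ≤ x → InMonoid (gens n k) x
  cofinite = gens-cofinite n k c 0<n residue-bound

weight-<-[1+q]*2^k : ∀ q k r → r < suc q * 2 ^ k → weight k r ≤ q + k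
weight-<-[1+q]*2^k q k r r<[1+q]*2^k = begin
  weight k r                           ≡⟨ cong (weight k) r≡ ⟩
  weight k (r / 2 ^ k * 2 ^ k + r % 2 ^ k) ≡⟨ weight-shift k _ _ ⟩
  r / 2 ^ k + weight k (r % 2 ^ k)     ≤⟨ +-mono-≤ (≤-pred quotient<) (weight-<-pow ≤-refl (m%n<n r (2 ^ k))) ⟩
  q + k                                ∎
  where
  open ≤-Reasoning
  instance _ = m^n≢0 2 k
  r≡ : r ≡ r / 2 ^ k * 2 ^ k + r % 2 ^ k
  r≡ = trans (m≡m%n+[m/n]*n r (2 ^ k)) (+-comm (r % 2 ^ k) _)
  quotient< : r / 2 ^ k < suc q
  quotient< = j*n+r<n*c⇒j<c (r / 2 ^ k) (r % 2 ^ k) (2 ^ k) (suc q)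
    (subst₂ _<_ r≡ (*-comm (suc q) (2 ^ k)) r<[1+q]*2^k)

weight-pred-[1+q]*2^k : ∀ q k s r → suc r ≡ suc q * 2 ^ k * suc s → q + k ≤ weight k r
weight-pred-[1+q]*2^k q k s r 1+r≡ = begin
  q + k                    ≤⟨ +-monoˡ-≤ k (≤-trans (m≤m*n q (suc s)) (m≤n+m _ s)) ⟩
  (s + q * suc s) + k      ≡⟨ sym (weight-pred-a*2^k+2^v (s + q * suc s) ≤-refl (trans 1+r≡ (regroup q (2 ^ k) s))) ⟩
  weight k r               ∎
  where
  open ≤-Reasoning
  regroup : ∀ q d s → suc q * d * suc s ≡ (s + q * suc s) * d + d
  regroup = ℕ-Ring.solve-∀

weight-<-[1+2p]*2^v : ∀ p v r → r < suc (2 * p) * 2 ^ v → weight (suc v) r ≤ p + v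
weight-<-[1+2p]*2^v p v r r<n with <-≤-connex r (p * 2 ^ suc v)
... | inj₁ r<p*2^k = low p r<p*2^k
  where
  low : ∀ p → r < p * 2 ^ suc v → weight (suc v) r ≤ p + v
  low zero ()
  low (suc p) r<[1+p]*2^k = ≤-trans (weight-<-[1+q]*2^k p (suc v) r r<[1+p]*2^k) (≤-reflexive (+-suc p v))
... | inj₂ p*2^k≤r with m≤n⇒∃[o]m+o≡n p*2^k≤r
...   | b , refl = begin
  weight (suc v) (p * 2 ^ suc v + b) ≡⟨ weight-shift (suc v) p b ⟩
  p + weight (suc v) b               ≤⟨ +-monoʳ-≤ p (weight-<-pow (n≤1+n v) b<2^v) ⟩
  p + v                              ∎
  where
  open ≤-Reasoning
  split : ∀ p x → suc (2 * p) * x ≡ p * (2 * x) + x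
  split = ℕ-Ring.solve-∀
  b<2^v : b < 2 ^ v
  b<2^v = +-cancelˡ-< (p * 2 ^ suc v) b (2 ^ v) (subst (p * 2 ^ suc v + b <_) (split p (2 ^ v)) r<n)

weight-pred-[1+2p]*2^v : ∀ p v s r → suc r ≡ suc (2 * p) * 2 ^ v * suc s → p + v ≤ weight (suc v) r
weight-pred-[1+2p]*2^v p v s r 1+r≡ with halving s
... | even w = begin
  p + v                        ≤⟨ +-monoˡ-≤ v (≤-trans (m≤m+n p w) (m≤m+n (p + w) _)) ⟩
  (p + w + 2 * p * w) + v      ≡⟨ sym (weight-pred-a*2^k+2^v _ (n≤1+n v) (trans 1+r≡ (regroup p (2 ^ v) w))) ⟩
  weight (suc v) r             ∎
  where
  open ≤-Reasoning
  regroup : ∀ p x w → suc (2 * p) * x * suc (2 * w) ≡ (p + w + 2 * p * w) * (2 * x) + x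
  regroup = ℕ-Ring.solve-∀
... | odd w = begin
  p + v                        ≤⟨ +-mono-≤ p≤ (n≤1+n v) ⟩
  (w + 2 * p * suc w) + suc v  ≡⟨ sym (weight-pred-a*2^k+2^v _ ≤-refl (trans 1+r≡ (regroup p (2 ^ v) w))) ⟩
  weight (suc v) r             ∎
  where
  open ≤-Reasoning
  regroup : ∀ p x w → suc (2 * p) * x * suc (1 + 2 * w) ≡ (w + 2 * p * suc w) * (2 * x) + 2 * x
  regroup = ℕ-Ring.solve-∀
  p≤ : p ≤ w + 2 * p * suc w
  p≤ = ≤-trans (m≤m+n p (p + 0)) (≤-trans (m≤m*n (2 * p) (suc w)) (m≤n+m _ w))

ℕ-identity⇒frobenius-formula : ∀ e N b a c n d → e * N + c * n * d ≡ b + a * n * d →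
  + e ℤ.* ((+ N ℤ.- + 1) ℤ.+ + 1) ≡ + b ℤ.+ (+ a ℤ.- + c) ℤ.* + n ℤ.* + d
ℕ-identity⇒frobenius-formula e N b a c n d eq = begin
  + e ℤ.* ((+ N ℤ.- + 1) ℤ.+ + 1)                     ≡⟨ add-sub (+ e) (+ N) (+ c ℤ.* + n ℤ.* + d) ⟩
  (+ e ℤ.* + N ℤ.+ + c ℤ.* + n ℤ.* + d) ℤ.- + c ℤ.* + n ℤ.* + d ≡⟨ cong (ℤ._- + c ℤ.* + n ℤ.* + d) cast ⟩
  (+ b ℤ.+ + a ℤ.* + n ℤ.* + d) ℤ.- + c ℤ.* + n ℤ.* + d ≡⟨ collect (+ b) (+ a) (+ c) (+ n) (+ d) ⟩
  + b ℤ.+ (+ a ℤ.- + c) ℤ.* + n ℤ.* + d               ∎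
  where
  open ≡-Reasoning
  add-sub : ∀ e N x → e ℤ.* ((N ℤ.- + 1) ℤ.+ + 1) ≡ (e ℤ.* N ℤ.+ x) ℤ.- x
  add-sub = ℤ-Ring.solve-∀
  collect : ∀ b a c n d → (b ℤ.+ a ℤ.* n ℤ.* d) ℤ.- c ℤ.* n ℤ.* d ≡ b ℤ.+ (a ℤ.- c) ℤ.* n ℤ.* d
  collect = ℤ-Ring.solve-∀
  pos-*₃ : ∀ x y z → + (x * y * z) ≡ + x ℤ.* + y ℤ.* + z
  pos-*₃ x y z = trans (ℤP.pos-* (x * y) z) (cong (ℤ._* + z) (ℤP.pos-* x y))
  cast : + e ℤ.* + N ℤ.+ + c ℤ.* + n ℤ.* + d ≡ + b ℤ.+ + a ℤ.* + n ℤ.* + d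
  cast = begin
    + e ℤ.* + N ℤ.+ + c ℤ.* + n ℤ.* + d ≡⟨ sym (cong₂ ℤ._+_ (ℤP.pos-* e N) (pos-*₃ c n d)) ⟩
    + (e * N) ℤ.+ + (c * n * d)         ≡⟨ sym (ℤP.pos-+ (e * N) (c * n * d)) ⟩
    + (e * N + c * n * d)               ≡⟨ cong +_ eq ⟩
    + (b + a * n * d)                   ≡⟨ ℤP.pos-+ b (a * n * d) ⟩
    + b ℤ.+ + (a * n * d)               ≡⟨ cong (ℤ._+_ (+ b)) (pos-*₃ a n d) ⟩
    + b ℤ.+ + a ℤ.* + n ℤ.* + d         ∎

nonzero-cofactor : ∀ {n d} → d ∣ n → 0 < n → ∃[ q ] n ≡ suc q * d
nonzero-cofactor (divides (suc q) n≡) _ = q , n≡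
nonzero-cofactor (divides zero refl) ()

2^k∣2^[k+t] : ∀ k t → 2 ^ k ∣ 2 ^ (k + t)
2^k∣2^[k+t] k t = divides (2 ^ t) (trans (^-distribˡ-+-* 2 k t) (*-comm (2 ^ k) (2 ^ t)))

ν₂-cases : ∀ {n k v} → 0 < n → IsNu2 n v → k ≤ suc v →
  (k ≤ v × ∃[ q ] n ≡ suc q * 2 ^ k) ⊎ (k ≡ suc v × ∃[ p ] n ≡ suc (2 * p) * 2 ^ v)
ν₂-cases {k = k} 0<n (2^v∣n , 2^[1+v]∤n) k≤1+v with m≤n⇒m<n∨m≡n k≤1+v
... | inj₁ (s≤s k≤v) with m≤n⇒∃[o]m+o≡n k≤v
...   | t , refl = inj₁ (k≤v , nonzero-cofactor (∣-trans (2^k∣2^[k+t] k t) 2^v∣n) 0<n)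
ν₂-cases {v = v} 0<n (divides m n≡m*2^v , 2^[1+v]∤n) _ | inj₂ refl with halving m
... | even a = contradiction (divides a (trans n≡m*2^v (regroup a (2 ^ v)))) 2^[1+v]∤n
  where
  regroup : ∀ a x → 2 * a * x ≡ a * (2 * x)
  regroup = ℕ-Ring.solve-∀
... | odd p = inj₂ (refl , p , n≡m*2^v)

frobenius-[1+q]*2^k : ∀ q k → let n = suc q * 2 ^ k in 0 < n →
  IsNumericalSemigroup (InMonoid (gens n k)) × Σ ℤ λ F → IsFrobenius (InMonoid (gens n k)) F ×
    + (2 ^ k) ℤ.* (F ℤ.+ + 1) ≡ + (n * n) ℤ.+ ((+ k) ℤ.- + 1) ℤ.* (+ n) ℤ.* (+ (2 ^ k))
frobenius-[1+q]*2^k q k 0<n =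
  let numerical , frobenius =
        gens-frobenius _ k (q + k) 0<n (weight-<-[1+q]*2^k q k) (weight-pred-[1+q]*2^k q k)
      n = suc q * 2 ^ k
  in numerical , _ , frobenius ,
     ℕ-identity⇒frobenius-formula (2 ^ k) (n * (q + k)) (n * n) k 1 n (2 ^ k) (identity q k (2 ^ k))
  where
  identity : ∀ q k d → let n = suc q * d in d * (n * (q + k)) + 1 * n * d ≡ n * n + k * n * d
  identity = ℕ-Ring.solve-∀

frobenius-[1+2p]*2^v : ∀ p v → let n = suc (2 * p) * 2 ^ v; k = suc v in 0 < n →
  IsNumericalSemigroup (InMonoid (gens n k)) × Σ ℤ λ F → IsFrobenius (InMonoid (gens n k)) F ×
    + (2 ^ suc k) ℤ.* (F ℤ.+ + 1) ≡ + (2 * n * n) ℤ.+ ((+ (2 * k)) ℤ.- + 3) ℤ.* (+ n) ℤ.* (+ (2 ^ k))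
frobenius-[1+2p]*2^v p v 0<n =
  let numerical , frobenius =
        gens-frobenius _ (suc v) (p + v) 0<n (weight-<-[1+2p]*2^v p v) (weight-pred-[1+2p]*2^v p v)
      n = suc (2 * p) * 2 ^ v
  in numerical , _ , frobenius ,
     ℕ-identity⇒frobenius-formula (2 ^ suc (suc v)) (n * (p + v)) (2 * n * n) (2 * suc v) 3 n (2 ^ suc v)
       (identity p v (2 ^ v))
  where
  identity : ∀ p v x → let n = suc (2 * p) * x in
    2 * (2 * x) * (n * (p + v)) + 3 * n * (2 * x) ≡ 2 * n * n + 2 * suc v * n * (2 * x)
  identity = ℕ-Ring.solve-∀

theorem1p2 : (n k v : ℕ) → 0 < n → IsNu2 n v → k ≤ suc v →
    IsNumericalSemigroup (InMonoid (gens n k))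
    × Σ ℤ (λ F → IsFrobenius (InMonoid (gens n k)) F
        × (k ≤ v → (+ (2 ^ k)) ℤ.* (F ℤ.+ + 1)
                    ≡ + (n * n) ℤ.+ ((+ k) ℤ.- + 1) ℤ.* (+ n) ℤ.* (+ (2 ^ k)))
        × (k ≡ suc v → (+ (2 ^ suc k)) ℤ.* (F ℤ.+ + 1)
                    ≡ + (2 * n * n) ℤ.+ ((+ (2 * k)) ℤ.- + 3) ℤ.* (+ n) ℤ.* (+ (2 ^ k))))
theorem1p2 n k v 0<n ν₂[n]≡v k≤1+v with ν₂-cases 0<n ν₂[n]≡v k≤1+v
... | inj₁ (k≤v , q , refl) with frobenius-[1+q]*2^k q k 0<n
...   | numerical , F , frobenius , formula =
  numerical , F , frobenius , (λ _ → formula) , λ { refl → contradiction k≤v (n≮n v) }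
theorem1p2 _ _ v 0<n _ _ | inj₂ (refl , p , refl) with frobenius-[1+2p]*2^v p v 0<n
...   | numerical , F , frobenius , formula =
  numerical , F , frobenius , (λ 1+v≤v → contradiction 1+v≤v (n≮n v)) , λ _ → formula
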